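{- For a positive integer $m$ let $h(m)=2^{v_2(m)}3^{v_3(m)}$ and $S(m)=h(5m+1)$. Then for every integer $a\ge 1$, either $S(4^a)<4^a$ or $S(S(4^a))<4^a$.
   Context: $v_p(m)$ denotes the exponent of the prime $p$ in $m$; $h(m)$ is the largest divisor of $m$ whose only prime factors are $2$ and $3$. -}

module Defs where

open import Data.Nat using (ℕ; zero; suc; _+_; _*_; _^_)
open import Data.Nat.Divisibility using (_∣?_)
open import Data.Nat.DivMod using (_/_)
open import Relation.Nullary using (yes; no)

-- vAux fuel p m : number of times p divides m, stripping at most `fuel` times.
-- For p ≥ 2 and m ≥ 1, fuel = m suffices since p^k ∣ m implies k < m.
vAux : ℕ → (p : ℕ) → ℕ → ℕ
vAux zero    p m = zero
vAux (suc f) zero m = zero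
vAux (suc f) (suc q) m with suc q ∣? m
... | yes _ = suc (vAux f (suc q) (m / suc q))
... | no  _ = zero

v : (p m : ℕ) → ℕ
v p m = vAux m p m

h : ℕ → ℕ
h m = 2 ^ v 2 m * 3 ^ v 3 m

S : ℕ → ℕ
S m = h (5 * m + 1)

-- Write n = 4^a; all that matters is 4 ∣ n and 3 ∤ n. Since n is even, 5n + 1 is odd,
-- so S(n) = 3^k with k = v₃(5n + 1). If S(n) ≥ n, the cofactor c of 3^k in 5n + 1
-- satisfies c < 6, and c is prime to 2, 3 and 5, so c = 1: S(n) = 5n + 1. Then
-- 5 S(n) + 1 = 25n + 6 is twice an odd number (as 4 ∣ n) and is prime to 3 (as 3 ∤ n),
-- so S(S(n)) = 2 < n.
module Submission where

open import Defs
open import Data.Nat using (ℕ; zero; suc; _+_; _*_; _^_; _<_; _≤_; _<?_; z≤n; s≤s; NonZero; >-nonZero)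
open import Data.Nat.Properties
open import Data.Nat.Divisibility
open import Data.Nat.DivMod using (_/_; m*n/n≡m; m/n*n≡m; m*[n/m]≡n; m≥n⇒m/n>0; m<n*o⇒m/o<n)
open import Data.Nat.Tactic.RingSolver using (solve-∀)
open import Data.Sum using (_⊎_; inj₁; inj₂)
open import Function using (_∘_)
open import Relation.Nullary using (yes; no; contradiction)
open import Relation.Binary.PropositionalEquality

n<m^n : ∀ m → 1 < m → ∀ n → n < m ^ n
n<m^n m 1<m zero    = s≤s z≤n
n<m^n m 1<m (suc n) = ≤-<-trans (n<m^n m 1<m n) (^-monoʳ-< m 1<m (n<1+n n))

n∤k*n+r : ∀ {n r} k → .{{NonZero r}} → r < n → n ∤ k * n + r
n∤k*n+r k r<n n∣kn+r = >⇒∤ r<n (∣m+n∣m⇒∣n n∣kn+r (n∣m*n k))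

vAux-∤ : ∀ f {p m} → p ∤ m → vAux f p m ≡ 0
vAux-∤ zero            _   = refl
vAux-∤ (suc f) {zero}  _   = refl
vAux-∤ (suc f) {suc q} {m} p∤m with suc q ∣? m
... | yes p∣m = contradiction p∣m p∤m
... | no  _   = refl

vAux-∣ : ∀ f {q m} → suc q ∣ m → vAux (suc f) (suc q) m ≡ suc (vAux f (suc q) (m / suc q))
vAux-∣ f {q} {m} p∣m with suc q ∣? m
... | yes _   = refl
... | no  p∤m = contradiction p∣m p∤m

vAux-pow-∣ : ∀ f p m → p ^ vAux f p m ∣ m
vAux-pow-∣ zero    p       m = 1∣ m
vAux-pow-∣ (suc f) zero    m = 1∣ m
vAux-pow-∣ (suc f) (suc q) m with suc q ∣? m
... | no  _   = 1∣ m
... | yes p∣m = subst (suc q ^ suc (vAux f (suc q) (m / suc q)) ∣_) (m*[n/m]≡n p∣m)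
                  (*-monoʳ-∣ (suc q) (vAux-pow-∣ f (suc q) (m / suc q)))

-- The fuel bound m < p ^ f guarantees that the fuel outlasts the divisions by p.
vAux-maximal : ∀ f {q m} → 0 < m → m < suc q ^ f → suc q ^ suc (vAux f (suc q) m) ∤ m
vAux-maximal zero {m = suc _} _ (s≤s ())
vAux-maximal (suc f) {q} {m} 0<m m<pᶠ⁺¹ with suc q ∣? m
... | no  p∤m = p∤m ∘ ∣-trans (m∣m*n 1)
... | yes p∣m = vAux-maximal f 0<m/p m/p<pᶠ ∘ *-cancelʳ-∣ (suc q)
                ∘ subst₂ _∣_ (*-comm (suc q) _) (sym (m/n*n≡m p∣m))
  where
  0<m/p : 0 < m / suc q
  0<m/p = m≥n⇒m/n>0 (∣⇒≤ {{>-nonZero 0<m}} p∣m)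
  m/p<pᶠ : m / suc q < suc q ^ f
  m/p<pᶠ = m<n*o⇒m/o<n (subst (m <_) (*-comm (suc q) _) m<pᶠ⁺¹)

v-maximal : ∀ {p m} → 1 < p → 0 < m → p ^ suc (v p m) ∤ m
v-maximal {suc q} {m} 1<p 0<m = vAux-maximal m 0<m (n<m^n (suc q) 1<p m)

v[m*p]≡1 : ∀ {q m} → suc q ∤ m → v (suc q) (m * suc q) ≡ 1
v[m*p]≡1 {q} {zero}    p∤m = contradiction (suc q ∣0) p∤m
v[m*p]≡1 {q} {m@(suc n)} p∤m = begin
  vAux (suc f) (suc q) (m * suc q)          ≡⟨ vAux-∣ f (n∣m*n m) ⟩
  suc (vAux f (suc q) (m * suc q / suc q))  ≡⟨ cong (suc ∘ vAux f (suc q)) (m*n/n≡m m (suc q)) ⟩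
  suc (vAux f (suc q) m)                    ≡⟨ cong suc (vAux-∤ f p∤m) ⟩
  1                                         ∎
  where
  open ≡-Reasoning
  f : ℕ
  f = q + n * suc q

h-odd : ∀ {m} → 2 ∤ m → h m ≡ 3 ^ v 3 m
h-odd {m} 2∤m = trans (cong (λ e → 2 ^ e * 3 ^ v 3 m) (vAux-∤ m 2∤m)) (*-identityˡ _)

h[m*2]≡2 : ∀ {m} → 2 ∤ m → 3 ∤ m * 2 → h (m * 2) ≡ 2
h[m*2]≡2 {m} 2∤m 3∤2m = cong₂ (λ i j → 2 ^ i * 3 ^ j) (v[m*p]≡1 2∤m) (vAux-∤ (m * 2) 3∤2m)

d∣m∧m<6d⇒d≡m : ∀ {d m} → d ∣ m → m < 6 * d → 2 ∤ m → 3 * d ∤ m → 5 ∤ m → d ≡ m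
d∣m∧m<6d⇒d≡m (divides 0 refl) _ 2∤m _ _ = contradiction (2 ∣0) 2∤m
d∣m∧m<6d⇒d≡m {d} (divides 1 refl) _ _ _ _ = sym (*-identityˡ d)
d∣m∧m<6d⇒d≡m {d} (divides 2 refl) _ 2∤m _ _ = contradiction (m∣m*n d) 2∤m
d∣m∧m<6d⇒d≡m (divides 3 refl) _ _ 3d∤m _ = contradiction ∣-refl 3d∤m
d∣m∧m<6d⇒d≡m {d} (divides 4 refl) _ 2∤m _ _ = contradiction (∣-trans (divides 2 refl) (m∣m*n d)) 2∤m
d∣m∧m<6d⇒d≡m {d} (divides 5 refl) _ _ _ 5∤m = contradiction (m∣m*n d) 5∤m
d∣m∧m<6d⇒d≡m {d} (divides (suc (suc (suc (suc (suc (suc c)))))) refl) m<6d _ _ _ =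
  contradiction (*-monoˡ-≤ d (m≤m+n 6 c)) (<⇒≱ m<6d)

5*m+1<6*n : ∀ {m n} → m ≤ n → 1 < n → 5 * m + 1 < 6 * n
5*m+1<6*n {m} {n} m≤n 1<n = begin-strict
  5 * m + 1  ≤⟨ +-monoˡ-≤ 1 (*-monoʳ-≤ 5 m≤n) ⟩
  5 * n + 1  <⟨ +-monoʳ-< (5 * n) 1<n ⟩
  5 * n + n  ≡⟨ +-comm (5 * n) n ⟩
  6 * n      ∎
  where open ≤-Reasoning

n≤Sn⇒Sn≡5n+1 : ∀ {n} → 2 ∣ n → 1 < n → n ≤ S n → S n ≡ 5 * n + 1
n≤Sn⇒Sn≡5n+1 {n} (divides j refl) 1<n n≤Sn = begin
  S n        ≡⟨ Sn≡3ᵏ ⟩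
  3 ^ v 3 M  ≡⟨ d∣m∧m<6d⇒d≡m (vAux-pow-∣ M 3 M) M<6*3ᵏ M-odd 3ᵏ⁺¹∤M 5∤M ⟩
  M          ∎
  where
  open ≡-Reasoning
  M : ℕ
  M = 5 * n + 1
  M-odd : 2 ∤ M
  M-odd = subst (2 ∤_) (cong (_+ 1) (*-assoc 5 j 2)) (n∤k*n+r (5 * j) (s≤s (s≤s z≤n)))
  5∤M : 5 ∤ M
  5∤M = subst (5 ∤_) (cong (_+ 1) (*-comm n 5)) (n∤k*n+r n (s≤s (s≤s z≤n)))
  3ᵏ⁺¹∤M : 3 ^ suc (v 3 M) ∤ M
  3ᵏ⁺¹∤M = v-maximal (s≤s (s≤s z≤n)) (m≤n+m 1 (5 * n))
  Sn≡3ᵏ : S n ≡ 3 ^ v 3 M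
  Sn≡3ᵏ = h-odd M-odd
  n≤3ᵏ : n ≤ 3 ^ v 3 M
  n≤3ᵏ = subst (n ≤_) Sn≡3ᵏ n≤Sn
  M<6*3ᵏ : M < 6 * 3 ^ v 3 M
  M<6*3ᵏ = 5*m+1<6*n n≤3ᵏ (<-≤-trans 1<n n≤3ᵏ)

S[5n+1]≡2 : ∀ {n} → 4 ∣ n → 3 ∤ n → S (5 * n + 1) ≡ 2
S[5n+1]≡2 {n} (divides j refl) 3∤n =
  trans (cong h (N≡2*odd j)) (h[m*2]≡2 (n∤k*n+r (25 * j + 1) (s≤s (s≤s z≤n))) 3∤N)
  where
  N≡2*odd : ∀ j → 5 * (5 * (j * 4) + 1) + 1 ≡ ((25 * j + 1) * 2 + 1) * 2
  N≡2*odd = solve-∀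
  N≡3*+n : ∀ j → ((25 * j + 1) * 2 + 1) * 2 ≡ (32 * j + 2) * 3 + j * 4
  N≡3*+n = solve-∀
  3∤N : 3 ∤ ((25 * j + 1) * 2 + 1) * 2
  3∤N 3∣N = 3∤n (∣m+n∣m⇒∣n (subst (3 ∣_) (N≡3*+n j) 3∣N) (n∣m*n (32 * j + 2)))

Sn<n⊎S[Sn]<n : ∀ n → 4 ∣ n → 3 ∤ n → S n < n ⊎ S (S n) < n
Sn<n⊎S[Sn]<n zero    _   3∤n = contradiction (3 ∣0) 3∤n
Sn<n⊎S[Sn]<n n@(suc _) 4∣n 3∤n with S n <? n
... | yes Sn<n = inj₁ Sn<n
... | no  Sn≮n = inj₂ (begin-strict
  S (S n)          ≡⟨ cong S (n≤Sn⇒Sn≡5n+1 2∣n (<-≤-trans (s≤s (s≤s z≤n)) 4≤n) (≮⇒≥ Sn≮n)) ⟩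
  S (5 * n + 1)    ≡⟨ S[5n+1]≡2 4∣n 3∤n ⟩
  2                <⟨ <-≤-trans (s≤s (s≤s (s≤s z≤n))) 4≤n ⟩
  n                ∎)
  where
  open ≤-Reasoning
  4≤n : 4 ≤ n
  4≤n = ∣⇒≤ 4∣n
  2∣n : 2 ∣ n
  2∣n = ∣-trans (divides 2 refl) 4∣n

3∤4^n : ∀ n → 3 ∤ 4 ^ n
3∤4^n zero    = >⇒∤ (s≤s (s≤s z≤n))
3∤4^n (suc n) 3∣4ⁿ⁺¹ = 3∤4^n n (∣m+n∣m⇒∣n (subst (3 ∣_) (4*x≡x*3+x (4 ^ n)) 3∣4ⁿ⁺¹) (n∣m*n (4 ^ n)))
  where
  4*x≡x*3+x : ∀ x → 4 * x ≡ x * 3 + x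
  4*x≡x*3+x = solve-∀

lemma4p1 : ∀ (a : ℕ) → 1 ≤ a → S (4 ^ a) < 4 ^ a ⊎ S (S (4 ^ a)) < 4 ^ a
lemma4p1 (suc b) _ = Sn<n⊎S[Sn]<n (4 ^ suc b) (m∣m*n (4 ^ b)) (3∤4^n (suc b))
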